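{- Let $n$ be a positive integer and $\delta$ an odd integer with $|\delta| > 1$ such that both $n$ and $n+\delta$ are perfect numbers. Then $\delta \nmid n$.
   Context: A positive integer $N$ is perfect if $\sigma(N) = 2N$, where $\sigma$ denotes the sum-of-divisors function. -}

module Defs where

open import Data.Nat using (ℕ; zero; suc; _+_; _*_; _<_)
open import Data.Nat.Divisibility using (_∣_; _∣?_)
open import Data.List using (List; filter; upTo; map)
open import Data.Nat.ListAction using (sum)
open import Relation.Binary.PropositionalEquality using (_≡_)
open import Data.Product using (_×_)

divisorsList : ℕ → List ℕ
divisorsList N = filter (λ d → d ∣? N) (map suc (upTo N))

σ : ℕ → ℕ
σ N = sum (divisorsList N)

Perfect : ℕ → Set
Perfect N = 0 < N × σ N ≡ 2 * N

open import Data.Product using (Σ)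
import Data.Integer as ℤ
OddInt : ℤ.ℤ → Set
OddInt δ = Σ ℤ.ℤ (λ k → δ ≡ (ℤ.+ 2) ℤ.* k ℤ.+ ℤ.+ 1)

module Submission where

-- Write d = |δ|.  If d ∣ n then d divides both members of the pair, and since
-- d is odd exactly one member E is even.  By the Euclid–Euler theorem
-- E = 2^(k+1)·q with q = 2^(k+2) − 1 and q having no divisors besides 1 and q;
-- the odd divisor d > 1 of E is therefore q itself.  The other member O = E ± q
-- then equals q·t with 2t = q + 3 or 2t + 1 = q, and no such number is perfect:
-- if q ∤ t, multiplicativity of σ gives (q + 1) ∣ 2t, which is impossible for
-- these sizes of t; if q ∣ t, the only possibility is q = t = 3 and σ 9 ≠ 18.

open import Defs

module PerfectPairs where

  open import Data.Nat using (ℕ; zero; suc; _+_; _*_; _^_; _∸_; _≤_; _<_; z≤n; s≤s; s≤s⁻¹; NonZero; >-nonZero; ≢-nonZero)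
  open import Data.Nat.Properties
  open import Data.Nat.Divisibility
  open import Data.Nat.DivMod using (_%_; m%n<n; %-distribˡ-+)
  open import Data.Nat.Coprimality using (Coprime; coprime-divisor; coprime-/gcd; coprime-+; 1-coprimeTo)
  import Data.Nat.Coprimality as Coprimality
  open import Data.Nat.GCD using (gcd; gcd[m,n]∣m; gcd[m,n]∣n; gcd[m,n]≢0)
  open import Data.Nat.Primality using (Irreducible; prime⇒irreducible; prime[2])
  open import Data.Nat.Induction using (<-rec)
  open import Data.Nat.ListAction using (sum)
  open import Data.Nat.ListAction.Properties using (sum-++; sum-↭)
  open import Data.List using (List; []; _∷_; _++_; map; upTo; cartesianProductWith)
  open import Data.List.Relation.Unary.All using ([]; _∷_)
  import Data.List.Relation.Unary.All as All
  import Data.List.Relation.Unary.All.Properties as AllP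
  open import Data.List.Relation.Unary.Any using (here; there)
  open import Data.List.Relation.Unary.AllPairs using ([]; _∷_)
  open import Data.List.Relation.Unary.Unique.Propositional using (Unique)
  open import Data.List.Relation.Unary.Unique.Propositional.Properties using (filter⁺; map⁺; upTo⁺; ++⁺)
  open import Data.List.Relation.Binary.Disjoint.Propositional using (Disjoint)
  open import Data.List.Relation.Binary.Subset.Propositional using (_⊆_)
  open import Data.List.Membership.Propositional using (_∈_)
  open import Data.List.Membership.Propositional.Properties
    using (∈-∃++; ∈-map⁺; ∈-map⁻; ∈-filter⁺; ∈-filter⁻; ∈-upTo⁺; ∈-cartesianProductWith⁺; ∈-cartesianProductWith⁻)
  open import Data.List.Relation.Binary.Permutation.Propositional.Properties using (shift; ∈-resp-↭)
  open import Data.Product using (_×_; _,_; proj₁; proj₂; ∃; ∃₂)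
  open import Data.Sum using (_⊎_; inj₁; inj₂; fromInj₂)
  open import Data.Empty using (⊥; ⊥-elim)
  open import Relation.Binary.PropositionalEquality
  open import Function using (_∘′_)
  open import Relation.Nullary using (¬_; yes; no; contradiction)


  sum-mono-⊆ : ∀ {xs ys : List ℕ} → Unique xs → xs ⊆ ys → sum xs ≤ sum ys
  sum-mono-⊆ {[]} _ _ = z≤n
  sum-mono-⊆ {x ∷ xs} (x∉xs ∷ xs-unique) xs⊆ys with ∈-∃++ (xs⊆ys (here refl))
  ... | ys₁ , ys₂ , refl = begin
    x + sum xs            ≤⟨ +-monoʳ-≤ x (sum-mono-⊆ xs-unique xs⊆rest) ⟩
    x + sum (ys₁ ++ ys₂)  ≡⟨ sym (sum-↭ (shift x ys₁ ys₂)) ⟩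
    sum (ys₁ ++ x ∷ ys₂)  ∎
    where
    open ≤-Reasoning
    xs⊆rest : xs ⊆ ys₁ ++ ys₂
    xs⊆rest v∈xs with ∈-resp-↭ (shift x ys₁ ys₂) (xs⊆ys (there v∈xs))
    ... | here refl = ⊥-elim (All.lookup x∉xs v∈xs refl)
    ... | there v∈rest = v∈rest

  sum-unique-⊆⊇ : ∀ {xs ys : List ℕ} → Unique xs → Unique ys → xs ⊆ ys → ys ⊆ xs → sum xs ≡ sum ys
  sum-unique-⊆⊇ xs-unique ys-unique xs⊆ys ys⊆xs =
    ≤-antisym (sum-mono-⊆ xs-unique xs⊆ys) (sum-mono-⊆ ys-unique ys⊆xs)

  divisor-pos : ∀ {d N} → 0 < N → d ∣ N → 0 < d
  divisor-pos {zero} 0<N 0∣N = contradiction (0∣⇒≡0 0∣N) (>⇒≢ 0<N)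
  divisor-pos {suc d} _ _ = s≤s z≤n

  record DivisorEnumeration (N : ℕ) (ds : List ℕ) : Set where
    field
      unique   : Unique ds
      sound    : ∀ {d} → d ∈ ds → d ∣ N
      complete : ∀ {d} → d ∣ N → d ∈ ds

  open DivisorEnumeration

  divisorsList-enumerates : ∀ {N} → 0 < N → DivisorEnumeration N (divisorsList N)
  divisorsList-enumerates {N} 0<N = record
    { unique   = filter⁺ (_∣? N) (map⁺ suc-injective (upTo⁺ N))
    ; sound    = λ d∈ → proj₂ (∈-filter⁻ (_∣? N) {xs = map suc (upTo N)} d∈)
    ; complete = complete′
    }
    where
    complete′ : ∀ {d} → d ∣ N → d ∈ divisorsList N
    complete′ {zero} 0∣N = contradiction (divisor-pos 0<N 0∣N) (λ ())
    complete′ {suc d} d∣N =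
      ∈-filter⁺ (_∣? N) (∈-map⁺ suc (∈-upTo⁺ (∣⇒≤ {{>-nonZero 0<N}} d∣N))) d∣N

  σ-enumeration : ∀ {N ds} → 0 < N → DivisorEnumeration N ds → σ N ≡ sum ds
  σ-enumeration {N} 0<N E = sum-unique-⊆⊇ (unique D) (unique E)
    (λ d∈ → complete E (sound D d∈)) (λ d∈ → complete D (sound E d∈))
    where
    D : DivisorEnumeration N (divisorsList N)
    D = divisorsList-enumerates 0<N

  σ-≥-sum : ∀ {N ds} → 0 < N → Unique ds → (∀ {d} → d ∈ ds → d ∣ N) → sum ds ≤ σ N
  σ-≥-sum 0<N ds-unique ds-sound =
    sum-mono-⊆ ds-unique (λ d∈ → complete (divisorsList-enumerates 0<N) (ds-sound d∈))

  σ-≥-three : ∀ {e N} → 1 < e → e < N → e ∣ N → 1 + e + N ≤ σ N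
  σ-≥-three {e} {N} 1<e e<N e∣N =
    subst (_≤ σ N) (cong (suc ∘′ (e +_)) (+-identityʳ N)) (σ-≥-sum 0<N distinct divides-N)
    where
    0<N : 0 < N
    0<N = <-trans (<-trans (s≤s z≤n) 1<e) e<N
    distinct : Unique (1 ∷ e ∷ N ∷ [])
    distinct = (<⇒≢ 1<e ∷ <⇒≢ (<-trans 1<e e<N) ∷ []) ∷ (<⇒≢ e<N ∷ []) ∷ [] ∷ []
    divides-N : ∀ {d} → d ∈ 1 ∷ e ∷ N ∷ [] → d ∣ N
    divides-N (here refl) = 1∣ N
    divides-N (there (here refl)) = e∣N
    divides-N (there (there (here refl))) = ∣-refl

  -- Every divisor of a·b is a product of a divisor of a and a divisor of b:
  -- write v = gcd(v,a)·f; then f is coprime to a / gcd(v,a) and divides b.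
  divisor-of-product-split : ∀ {a b v} → 0 < a → v ∣ a * b → ∃₂ λ e f → e ∣ a × f ∣ b × v ≡ e * f
  divisor-of-product-split {a} {b} {v} 0<a v∣ab = e , f , e∣a , f∣b , trans v≡f*e (*-comm f e)
    where
    e : ℕ
    e = gcd v a
    instance
      e≢0 : NonZero e
      e≢0 = ≢-nonZero (gcd[m,n]≢0 v a (inj₂ (>⇒≢ 0<a)))
    e∣v : e ∣ v
    e∣v = gcd[m,n]∣m v a
    e∣a : e ∣ a
    e∣a = gcd[m,n]∣n v a
    f a′ : ℕ
    f = quotient e∣v
    a′ = quotient e∣a
    v≡f*e : v ≡ f * e
    v≡f*e = m∣n⇒n≡quotient*m e∣v
    a≡a′*e : a ≡ a′ * e
    a≡a′*e = m∣n⇒n≡quotient*m e∣a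
    f⊥a′ : Coprime f a′
    f⊥a′ = subst₂ Coprime (n/m≡quotient e∣v) (n/m≡quotient e∣a) (coprime-/gcd v a)
    fe∣a′be : f * e ∣ a′ * b * e
    fe∣a′be = subst₂ _∣_ v≡f*e (begin
      a * b          ≡⟨ cong (_* b) a≡a′*e ⟩
      a′ * e * b     ≡⟨ *-assoc a′ e b ⟩
      a′ * (e * b)   ≡⟨ cong (a′ *_) (*-comm e b) ⟩
      a′ * (b * e)   ≡⟨ sym (*-assoc a′ b e) ⟩
      a′ * b * e     ∎) v∣ab
      where open ≡-Reasoning
    f∣b : f ∣ b
    f∣b = coprime-divisor f⊥a′ (*-cancelʳ-∣ e fe∣a′be)

  divisors-coprime : ∀ {a b m n} → Coprime a b → m ∣ a → n ∣ b → Coprime m n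
  divisors-coprime a⊥b m∣a n∣b (i∣m , i∣n) = a⊥b (∣-trans i∣m m∣a , ∣-trans i∣n n∣b)

  coprime-factorisation-unique : ∀ {a b w x y z} → Coprime a b →
    w ∣ a → x ∣ a → y ∣ b → z ∣ b → w * y ≡ x * z → w ≡ x × y ≡ z
  coprime-factorisation-unique {w = w} {x} {y} {z} a⊥b w∣a x∣a y∣b z∣b wy≡xz =
      ∣-antisym (coprime-divisor (divisors-coprime a⊥b w∣a z∣b) (divides y zx≡yw))
                (coprime-divisor (divisors-coprime a⊥b x∣a y∣b) (divides z (sym zx≡yw)))
    , ∣-antisym (coprime-divisor (Coprimality.sym (divisors-coprime a⊥b x∣a y∣b)) (divides w (sym wy≡xz)))
                (coprime-divisor (Coprimality.sym (divisors-coprime a⊥b w∣a z∣b)) (divides x wy≡xz))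
    where
    zx≡yw : z * x ≡ y * w
    zx≡yw = trans (*-comm z x) (trans (sym wy≡xz) (*-comm w y))

  map-unique-injectiveOn : ∀ {A B : Set} {f : A → B} {xs} →
    (∀ {x y} → x ∈ xs → y ∈ xs → f x ≡ f y → x ≡ y) → Unique xs → Unique (map f xs)
  map-unique-injectiveOn inj [] = []
  map-unique-injectiveOn inj (x∉xs ∷ xs-unique) =
    AllP.map⁺ (All.tabulate (λ y∈xs fx≡fy → All.lookup x∉xs y∈xs (inj (here refl) (there y∈xs) fx≡fy)))
    ∷ map-unique-injectiveOn (λ x∈ y∈ → inj (there x∈) (there y∈)) xs-unique

  cartesianProductWith-unique : ∀ {A B C : Set} {f : A → B → C} {xs ys} → Unique xs → Unique ys →
    (∀ {w x y z} → w ∈ xs → x ∈ xs → y ∈ ys → z ∈ ys → f w y ≡ f x z → w ≡ x × y ≡ z) →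
    Unique (cartesianProductWith f xs ys)
  cartesianProductWith-unique {xs = []} _ _ _ = []
  cartesianProductWith-unique {f = f} {x ∷ xs} {ys} (x∉xs ∷ xs-unique) ys-unique inj =
    ++⁺ (map-unique-injectiveOn (λ y∈ z∈ fxy≡fxz → proj₂ (inj (here refl) (here refl) y∈ z∈ fxy≡fxz))
                                ys-unique)
        (cartesianProductWith-unique xs-unique ys-unique (λ w∈ x∈ → inj (there w∈) (there x∈)))
        row-disjoint
    where
    row-disjoint : Disjoint (map (f x) ys) (cartesianProductWith f xs ys)
    row-disjoint (v∈row , v∈rest) with ∈-map⁻ (f x) v∈row | ∈-cartesianProductWith⁻ f xs ys v∈rest
    ... | y , y∈ys , refl | x′ , z , x′∈xs , z∈ys , fxy≡fx′z =
      All.lookup x∉xs x′∈xs (proj₁ (inj (here refl) (there x′∈xs) y∈ys z∈ys fxy≡fx′z))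

  sum-map-* : ∀ x (zs : List ℕ) → sum (map (x *_) zs) ≡ x * sum zs
  sum-map-* x [] = sym (*-zeroʳ x)
  sum-map-* x (z ∷ zs) = trans (cong (x * z +_) (sum-map-* x zs)) (sym (*-distribˡ-+ x z (sum zs)))

  sum-products : ∀ (xs ys : List ℕ) → sum (cartesianProductWith _*_ xs ys) ≡ sum xs * sum ys
  sum-products [] ys = refl
  sum-products (x ∷ xs) ys = begin
    sum (map (x *_) ys ++ cartesianProductWith _*_ xs ys)   ≡⟨ sum-++ (map (x *_) ys) _ ⟩
    sum (map (x *_) ys) + sum (cartesianProductWith _*_ xs ys) ≡⟨ cong₂ _+_ (sum-map-* x ys) (sum-products xs ys) ⟩
    x * sum ys + sum xs * sum ys                             ≡⟨ sym (*-distribʳ-+ (sum ys) x (sum xs)) ⟩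
    (x + sum xs) * sum ys                                    ∎
    where open ≡-Reasoning

  -- σ is multiplicative: the products of divisors of coprime a and b enumerate
  -- the divisors of a·b, each exactly once.
  σ-multiplicative : ∀ {a b} → 0 < a → 0 < b → Coprime a b → σ (a * b) ≡ σ a * σ b
  σ-multiplicative {a} {b} 0<a 0<b a⊥b = begin
    σ (a * b)                                  ≡⟨ σ-enumeration (*-mono-< 0<a 0<b) products-enumerate ⟩
    sum (cartesianProductWith _*_ das dbs)     ≡⟨ sum-products das dbs ⟩
    σ a * σ b                                  ∎
    where
    open ≡-Reasoning
    das dbs : List ℕ
    das = divisorsList a
    dbs = divisorsList b
    Da : DivisorEnumeration a das
    Da = divisorsList-enumerates 0<a
    Db : DivisorEnumeration b dbs
    Db = divisorsList-enumerates 0<b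
    products-enumerate : DivisorEnumeration (a * b) (cartesianProductWith _*_ das dbs)
    products-enumerate = record
      { unique   = cartesianProductWith-unique (unique Da) (unique Db) λ w∈ x∈ y∈ z∈ →
                     coprime-factorisation-unique a⊥b (sound Da w∈) (sound Da x∈) (sound Db y∈) (sound Db z∈)
      ; sound    = λ v∈ →
          let (x , y , x∈ , y∈ , v≡xy) = ∈-cartesianProductWith⁻ _*_ das dbs v∈
          in subst (_∣ a * b) (sym v≡xy) (*-pres-∣ (sound Da x∈) (sound Db y∈))
      ; complete = λ v∣ab →
          let (e , f , e∣a , f∣b , v≡ef) = divisor-of-product-split 0<a v∣ab
          in subst (_∈ _) (sym v≡ef) (∈-cartesianProductWith⁺ _*_ (complete Da e∣a) (complete Db f∣b))
      }

  irreducible-coprime : ∀ {p v} → Irreducible p → ¬ p ∣ v → Coprime p v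
  irreducible-coprime p-irr p∤v (i∣p , i∣v) with p-irr i∣p
  ... | inj₁ i≡1 = i≡1
  ... | inj₂ refl = contradiction i∣v p∤v

  2∤1 : ¬ 2 ∣ 1
  2∤1 2∣1 = contradiction (∣1⇒≡1 2∣1) λ ()

  odd-coprime-2 : ∀ {v} → ¬ 2 ∣ v → Coprime v 2
  odd-coprime-2 v-odd = Coprimality.sym (irreducible-coprime (prime⇒irreducible prime[2]) v-odd)

  powersOfTwo : ℕ → List ℕ
  powersOfTwo zero = 1 ∷ []
  powersOfTwo (suc k) = 1 ∷ map (2 *_) (powersOfTwo k)

  powersOfTwo-1-or-even : ∀ k {v} → v ∈ powersOfTwo k → v ≡ 1 ⊎ 2 ∣ v
  powersOfTwo-1-or-even zero (here refl) = inj₁ refl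
  powersOfTwo-1-or-even (suc k) (here refl) = inj₁ refl
  powersOfTwo-1-or-even (suc k) (there v∈) with ∈-map⁻ (2 *_) v∈
  ... | w , _ , refl = inj₂ (m∣m*n w)

  powersOfTwo-enumerates : ∀ k → DivisorEnumeration (2 ^ k) (powersOfTwo k)
  powersOfTwo-enumerates k = record { unique = unique′ k ; sound = sound′ k ; complete = complete′ k }
    where
    unique′ : ∀ k → Unique (powersOfTwo k)
    unique′ zero = [] ∷ []
    unique′ (suc k) = All.tabulate 1∉evens ∷ map⁺ (*-cancelˡ-≡ _ _ 2) (unique′ k)
      where
      1∉evens : ∀ {x} → x ∈ map (2 *_) (powersOfTwo k) → 1 ≢ x
      1∉evens x∈ 1≡x with ∈-map⁻ (2 *_) x∈
      ... | w , _ , refl = 2∤1 (subst (2 ∣_) (sym 1≡x) (m∣m*n w))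
    sound′ : ∀ k {v} → v ∈ powersOfTwo k → v ∣ 2 ^ k
    sound′ zero (here refl) = ∣-refl
    sound′ (suc k) (here refl) = 1∣ _
    sound′ (suc k) (there v∈) with ∈-map⁻ (2 *_) v∈
    ... | w , w∈ , refl = *-monoʳ-∣ 2 (sound′ k w∈)
    -- an even divisor of 2^(k+1) is twice a divisor of 2^k; an odd one divides 2^k, hence is 1
    complete′ : ∀ k {v} → v ∣ 2 ^ k → v ∈ powersOfTwo k
    complete′ zero v∣1 rewrite ∣1⇒≡1 v∣1 = here refl
    complete′ (suc k) {v} v∣2^k+1 with 2 ∣? v
    ... | yes (divides w refl) = there (subst (_∈ map (2 *_) (powersOfTwo k)) (*-comm 2 w)
            (∈-map⁺ (2 *_) {x = w} (complete′ k (*-cancelˡ-∣ 2 (subst (_∣ 2 * 2 ^ k) (*-comm w 2) v∣2^k+1)))))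
    ... | no v-odd with powersOfTwo-1-or-even k (complete′ k (coprime-divisor (odd-coprime-2 v-odd) v∣2^k+1))
    ...   | inj₁ refl = here refl
    ...   | inj₂ 2∣v = contradiction 2∣v v-odd

  σ-powerOfTwo : ∀ k → suc (σ (2 ^ k)) ≡ 2 ^ suc k
  σ-powerOfTwo k = trans (cong suc (σ-enumeration (m^n>0 2 k) (powersOfTwo-enumerates k))) (geometric k)
    where
    geometric : ∀ k → suc (sum (powersOfTwo k)) ≡ 2 ^ suc k
    geometric zero = refl
    geometric (suc k) = begin
      2 + sum (map (2 *_) (powersOfTwo k)) ≡⟨ cong (2 +_) (sum-map-* 2 (powersOfTwo k)) ⟩
      2 + 2 * sum (powersOfTwo k)          ≡⟨ sym (*-distribˡ-+ 2 1 (sum (powersOfTwo k))) ⟩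
      2 * suc (sum (powersOfTwo k))        ≡⟨ cong (2 *_) (geometric k) ⟩
      2 * 2 ^ suc k                        ∎
      where open ≡-Reasoning

  odd-coprime-powerOfTwo : ∀ k {u} → ¬ 2 ∣ u → Coprime (2 ^ k) u
  odd-coprime-powerOfTwo k u-odd (i∣2^k , i∣u)
    with powersOfTwo-1-or-even k (complete (powersOfTwo-enumerates k) i∣2^k)
  ... | inj₁ i≡1 = i≡1
  ... | inj₂ 2∣i = contradiction (∣-trans 2∣i i∣u) u-odd

  -- If σ u exceeds u by a proper divisor w of u, then w = 1: otherwise 1, w, u
  -- would already contribute more than u + w.
  σ-excess-divisor : ∀ {u w} → 0 < u → w ∣ u → w < u → σ u ≡ u + w → w ≡ 1
  σ-excess-divisor {w = zero} 0<u 0∣u _ _ = contradiction (0∣⇒≡0 0∣u) (>⇒≢ 0<u)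
  σ-excess-divisor {w = suc zero} _ _ _ _ = refl
  σ-excess-divisor {u} {w@(suc (suc _))} _ w∣u w<u σu≡u+w =
    contradiction (σ-≥-three (s≤s (s≤s z≤n)) w<u w∣u) (<⇒≱ (begin-strict
    σ u        ≡⟨ σu≡u+w ⟩
    u + w      ≡⟨ +-comm u w ⟩
    w + u      <⟨ n<1+n (w + u) ⟩
    1 + w + u  ∎))
    where open ≤-Reasoning

  σ≡suc⇒irreducible : ∀ {u} → 0 < u → σ u ≡ suc u → Irreducible u
  σ≡suc⇒irreducible {u} 0<u σu≡1+u {e} e∣u with e ≟ 1 | e ≟ u
  ... | yes e≡1 | _ = inj₁ e≡1
  ... | no _ | yes e≡u = inj₂ e≡u
  ... | no e≢1 | no e≢u = contradiction (σ-≥-three 1<e e<u e∣u) (<⇒≱ (begin-strict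
    σ u        ≡⟨ σu≡1+u ⟩
    1 + u      <⟨ s≤s (m<n+m u 0<e) ⟩
    1 + e + u  ∎))
    where
    open ≤-Reasoning
    0<e : 0 < e
    0<e = divisor-pos 0<u e∣u
    1<e : 1 < e
    1<e = ≤∧≢⇒< 0<e (e≢1 ∘′ sym)
    e<u : e < u
    e<u = ≤∧≢⇒< (∣⇒≤ {{>-nonZero 0<u}} e∣u) e≢u

  3≤σ-powerOfTwo : ∀ k → 3 ≤ σ (2 ^ suc k)
  3≤σ-powerOfTwo k =
    s≤s⁻¹ (subst (4 ≤_) (sym (σ-powerOfTwo (suc k))) (*-monoʳ-≤ 2 (^-monoʳ-≤ 2 {1} {suc k} (s≤s z≤n))))

  two-adic : ∀ N → 0 < N → ∃₂ λ k u → N ≡ 2 ^ k * u × ¬ 2 ∣ u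
  two-adic = <-rec (λ N → 0 < N → ∃₂ λ k u → N ≡ 2 ^ k * u × ¬ 2 ∣ u) step
    where
    step : ∀ N → (∀ {M} → M < N → 0 < M → ∃₂ λ k u → M ≡ 2 ^ k * u × ¬ 2 ∣ u) →
           0 < N → ∃₂ λ k u → N ≡ 2 ^ k * u × ¬ 2 ∣ u
    step N rec 0<N with 2 ∣? N
    ... | no N-odd = 0 , N , sym (*-identityˡ N) , N-odd
    ... | yes (divides M refl) with rec (m<m*n M 2 {{>-nonZero 0<M}} (s≤s (s≤s z≤n))) 0<M
      where
      0<M : 0 < M
      0<M = divisor-pos 0<N (m∣m*n 2)
    ...   | k , u , M≡2^k*u , u-odd = suc k , u , M*2≡2^k+1*u , u-odd
      where
      M*2≡2^k+1*u : M * 2 ≡ 2 ^ suc k * u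
      M*2≡2^k+1*u = begin
        M * 2           ≡⟨ *-comm M 2 ⟩
        2 * M           ≡⟨ cong (2 *_) M≡2^k*u ⟩
        2 * (2 ^ k * u) ≡⟨ sym (*-assoc 2 (2 ^ k) u) ⟩
        2 ^ suc k * u   ∎
        where open ≡-Reasoning

  -- Euclid–Euler, core computation: if 2^(k+1)·u is perfect with u odd then,
  -- writing c = σ(2^(k+1)), we get c·σ u = (c + 1)·u, so σ u = u + w with
  -- c·w = u; w is then a proper divisor of u, hence w = 1 and u = c.
  perfect-odd-part : ∀ k {u} → Perfect (2 ^ suc k * u) → ¬ 2 ∣ u → u ≡ σ (2 ^ suc k) × σ u ≡ suc u
  perfect-odd-part k {u} (0<E , σE≡2E) u-odd = u≡c , σu≡1+u
    where
    open ≡-Reasoning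
    P c : ℕ
    P = 2 ^ suc k
    c = σ P
    0<u : 0 < u
    0<u = divisor-pos 0<E (n∣m*n P {u})
    cσu≡cu+u : c * σ u ≡ c * u + u
    cσu≡cu+u = begin
      c * σ u       ≡⟨ sym (σ-multiplicative (m^n>0 2 (suc k)) 0<u (odd-coprime-powerOfTwo (suc k) u-odd)) ⟩
      σ (P * u)     ≡⟨ σE≡2E ⟩
      2 * (P * u)   ≡⟨ sym (*-assoc 2 P u) ⟩
      2 * P * u     ≡⟨ cong (_* u) (sym (σ-powerOfTwo (suc k))) ⟩
      suc c * u     ≡⟨ +-comm u (c * u) ⟩
      c * u + u     ∎
    w : ℕ
    w = σ u ∸ u
    cw≡u : c * w ≡ u
    cw≡u = begin
      c * (σ u ∸ u)      ≡⟨ *-distribˡ-∸ c (σ u) u ⟩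
      c * σ u ∸ c * u    ≡⟨ cong (_∸ c * u) cσu≡cu+u ⟩
      c * u + u ∸ c * u  ≡⟨ m+n∸m≡n (c * u) u ⟩
      u                  ∎
    0<w : 0 < w
    0<w = divisor-pos 0<u (divides c (sym cw≡u))
    σu≡u+w : σ u ≡ u + w
    σu≡u+w = sym (m+[n∸m]≡n (<⇒≤ (m∸n≢0⇒n<m {σ u} {u} (>⇒≢ 0<w))))
    w<u : w < u
    w<u = subst (w <_) (trans (*-comm w c) cw≡u)
                (m<m*n w c {{>-nonZero 0<w}} (<-trans (s≤s (s≤s z≤n)) (3≤σ-powerOfTwo k)))
    w≡1 : w ≡ 1
    w≡1 = σ-excess-divisor 0<u (divides c (sym cw≡u)) w<u σu≡u+w
    u≡c : u ≡ c
    u≡c = trans (sym cw≡u) (trans (cong (c *_) w≡1) (*-identityʳ c))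
    σu≡1+u : σ u ≡ suc u
    σu≡1+u = trans σu≡u+w (trans (cong (u +_) w≡1) (+-comm u 1))

  record EvenPerfectShape (E : ℕ) : Set where
    field
      k q           : ℕ
      E≡            : E ≡ 2 ^ suc k * q
      1+q≡          : suc q ≡ 2 ^ suc (suc k)
      σq≡1+q        : σ q ≡ suc q
      q-irreducible : Irreducible q
      3≤q           : 3 ≤ q

  even-perfect-shape : ∀ {E} → Perfect E → 2 ∣ E → EvenPerfectShape E
  even-perfect-shape {E} (0<E , σE≡2E) 2∣E with two-adic E 0<E
  ... | zero , u , E≡u , u-odd = contradiction (subst (2 ∣_) (trans E≡u (*-identityˡ u)) 2∣E) u-odd
  ... | suc k , u , E≡ , u-odd with perfect-odd-part k (subst Perfect E≡ (0<E , σE≡2E)) u-odd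
  ...   | u≡c , σu≡1+u = record
    { k             = k
    ; q             = u
    ; E≡            = E≡
    ; 1+q≡          = trans (cong suc u≡c) (σ-powerOfTwo (suc k))
    ; σq≡1+q        = σu≡1+u
    ; q-irreducible = σ≡suc⇒irreducible (divisor-pos 0<E (subst (u ∣_) (sym E≡) (n∣m*n (2 ^ suc k)))) σu≡1+u
    ; 3≤q           = subst (3 ≤_) (sym u≡c) (3≤σ-powerOfTwo k)
    }

  NearHalf : ℕ → ℕ → Set
  NearHalf q t = 2 * t ≡ q + 3 ⊎ suc (2 * t) ≡ q

  cofactor-pos : ∀ q {t} → Perfect (q * t) → 0 < t
  cofactor-pos q (0<qt , _) = divisor-pos 0<qt (n∣m*n q)

  -- If q·t is perfect, q ⊥ t and σ q = q + 1, then q + 1 divides 2t, because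
  -- (q + 1)·σ t = σ(q·t) = q·2t and q + 1 is coprime to q.
  perfect-coprime-cofactor : ∀ {q t} → Perfect (q * t) → Coprime q t → σ q ≡ suc q → suc q ∣ 2 * t
  perfect-coprime-cofactor {q} {t} (0<qt , σqt≡2qt) q⊥t σq≡1+q =
    coprime-divisor 1+q⊥q (divides (σ t) (begin
      q * (2 * t)   ≡⟨ *-comm q (2 * t) ⟩
      2 * t * q     ≡⟨ *-assoc 2 t q ⟩
      2 * (t * q)   ≡⟨ cong (2 *_) (*-comm t q) ⟩
      2 * (q * t)   ≡⟨ sym σqt≡2qt ⟩
      σ (q * t)     ≡⟨ σ-multiplicative (divisor-pos 0<qt (m∣m*n t)) (divisor-pos 0<qt (n∣m*n q)) q⊥t ⟩
      σ q * σ t     ≡⟨ cong (_* σ t) σq≡1+q ⟩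
      suc q * σ t   ≡⟨ *-comm (suc q) (σ t) ⟩
      σ t * suc q   ∎))
    where
    open ≡-Reasoning
    1+q⊥q : Coprime (suc q) q
    1+q⊥q = subst (λ m → Coprime m q) (+-comm q 1) (coprime-+ (1-coprimeTo q))

  -- When q ≥ 3 and t > 0, (q + 1) ∣ 2t rules out both shapes of t: for
  -- 2t = q + 3 it would give (q + 1) ∣ 2, for 2t + 1 = q we have 0 < 2t < q + 1.
  multiple-of-suc-not-near-half : ∀ {q t} → 3 ≤ q → 0 < t → suc q ∣ 2 * t → ¬ NearHalf q t
  multiple-of-suc-not-near-half {q} {t} 3≤q _ 1+q∣2t (inj₁ 2t≡q+3) =
    contradiction (∣⇒≤ 1+q∣2) (<⇒≱ (m≤n⇒m≤1+n 3≤q))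
    where
    1+q∣2 : suc q ∣ 2
    1+q∣2 = ∣m+n∣m⇒∣n (subst (suc q ∣_) (trans 2t≡q+3 (+-suc q 2)) 1+q∣2t) ∣-refl
  multiple-of-suc-not-near-half {q} {t} _ 0<t 1+q∣2t (inj₂ 2t+1≡q) =
    contradiction (∣⇒≤ {{>-nonZero (*-monoʳ-< 2 0<t)}} 1+q∣2t) (<⇒≱ (m<n⇒m<1+n 2t<q))
    where
    2t<q : 2 * t < q
    2t<q = subst (2 * t <_) 2t+1≡q ≤-refl

  -- When q ≥ 3 and t > 0, q ∣ t is compatible with t near q/2 only for q = t = 3:
  -- 2t + 1 = q forces t < q, and 2t = q + 3 forces q ∣ 3.
  multiple-near-half : ∀ {q t} → 3 ≤ q → 0 < t → q ∣ t → NearHalf q t → q ≡ 3 × t ≡ 3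
  multiple-near-half {q} {t} 3≤q _ q∣t (inj₁ 2t≡q+3) with ≤-antisym (∣⇒≤ q∣3) 3≤q
    where
    q∣3 : q ∣ 3
    q∣3 = ∣m+n∣m⇒∣n (subst (q ∣_) 2t≡q+3 (∣n⇒∣m*n 2 q∣t)) ∣-refl
  ... | refl = refl , *-cancelˡ-≡ t 3 2 2t≡q+3
  multiple-near-half {q} {t} _ 0<t q∣t (inj₂ 2t+1≡q) =
    contradiction (∣⇒≤ {{>-nonZero 0<t}} q∣t) (<⇒≱ t<q)
    where
    t<q : t < q
    t<q = subst (t <_) 2t+1≡q (s≤s (m≤m+n t (t + 0)))

  -- No perfect number has the form q·t with q ≥ 3 as in an even perfect number
  -- and t near q/2: if q ∤ t then (q + 1) ∣ 2t, and if q ∣ t then q·t = 9,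
  -- whereas σ 9 = 13 ≠ 18.
  no-perfect-near-half : ∀ {q t} → Perfect (q * t) → Irreducible q → σ q ≡ suc q → 3 ≤ q →
    NearHalf q t → ⊥
  no-perfect-near-half {q} {t} perfect q-irr σq≡1+q 3≤q near with q ∣? t
  ... | no q∤t = multiple-of-suc-not-near-half 3≤q (cofactor-pos q perfect)
                   (perfect-coprime-cofactor perfect (irreducible-coprime q-irr q∤t) σq≡1+q) near
  ... | yes q∣t with multiple-near-half 3≤q (cofactor-pos q perfect) q∣t near
  ...   | refl , refl = contradiction (proj₂ perfect) λ ()

  -- An odd divisor d > 1 of an even perfect number 2^(k+1)·q is q itself, since
  -- d is coprime to 2^(k+1) and q has no divisors besides 1 and q.
  odd-divisor-of-even-perfect : ∀ {E d} (S : EvenPerfectShape E) →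
    ¬ 2 ∣ d → 1 < d → d ∣ E → d ≡ EvenPerfectShape.q S
  odd-divisor-of-even-perfect {d = d} S d-odd 1<d d∣E =
    fromInj₂ (λ d≡1 → contradiction d≡1 (>⇒≢ 1<d)) (q-irreducible d∣q)
    where
    open EvenPerfectShape S
    d∣q : d ∣ q
    d∣q = coprime-divisor (Coprimality.sym (odd-coprime-powerOfTwo (suc k) d-odd)) (subst (d ∣_) E≡ d∣E)

  AtDistance : ℕ → ℕ → ℕ → Set
  AtDistance d E O = O ≡ E + d ⊎ O + d ≡ E

  -- If q + 1 = 2P, the numbers at distance q from P·q are q·t with t near q/2:
  -- P·q + q = q·(P + 1) and P·q − q = q·(P − 1).
  neighbours-near-half : ∀ {P q O} → 0 < P → suc q ≡ 2 * P → AtDistance q (P * q) O →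
    ∃ λ t → O ≡ q * t × NearHalf q t
  neighbours-near-half {suc p} {q} {O} _ 1+q≡2P (inj₁ O≡Pq+q) = suc (suc p) , O≡q[P+1] , inj₁ 2[P+1]≡q+3
    where
    open ≡-Reasoning
    O≡q[P+1] : O ≡ q * suc (suc p)
    O≡q[P+1] = begin
      O                  ≡⟨ O≡Pq+q ⟩
      suc p * q + q      ≡⟨ +-comm (suc p * q) q ⟩
      q + suc p * q      ≡⟨ cong (q +_) (*-comm (suc p) q) ⟩
      q + q * suc p      ≡⟨ sym (*-suc q (suc p)) ⟩
      q * suc (suc p)    ∎
    2[P+1]≡q+3 : 2 * suc (suc p) ≡ q + 3
    2[P+1]≡q+3 = begin
      2 * suc (suc p)    ≡⟨ *-suc 2 (suc p) ⟩
      2 + 2 * suc p      ≡⟨ cong (2 +_) (sym 1+q≡2P) ⟩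
      3 + q              ≡⟨ +-comm 3 q ⟩
      q + 3              ∎
  neighbours-near-half {suc p} {q} {O} _ 1+q≡2P (inj₂ O+q≡Pq) = p , O≡qp , inj₂ 2p+1≡q
    where
    O≡qp : O ≡ q * p
    O≡qp = +-cancelʳ-≡ q O (q * p) (trans O+q≡Pq (trans (+-comm q (p * q)) (cong (_+ q) (*-comm p q))))
    2p+1≡q : suc (2 * p) ≡ q
    2p+1≡q = suc-injective (sym (trans 1+q≡2P (*-suc 2 p)))

  -- No perfect number lies at an odd distance d > 1 from an even perfect
  -- number E with d ∣ E: such d equals q, and the neighbour is q·t with t near q/2.
  no-perfect-odd-neighbour : ∀ {E O d} → Perfect E → 2 ∣ E → ¬ 2 ∣ d → 1 < d → d ∣ E →
    AtDistance d E O → ¬ Perfect O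
  no-perfect-odd-neighbour {E} {O} pE 2∣E d-odd 1<d d∣E O-at-d pO =
    let t , O≡qt , t-near-half = neighbours-near-half (m^n>0 2 (suc k)) 1+q≡ O-at-q
    in no-perfect-near-half (subst Perfect O≡qt pO) q-irreducible σq≡1+q 3≤q t-near-half
    where
    S : EvenPerfectShape E
    S = even-perfect-shape pE 2∣E
    open EvenPerfectShape S
    O-at-q : AtDistance q (2 ^ suc k * q) O
    O-at-q = subst₂ (λ x y → AtDistance x y O) (odd-divisor-of-even-perfect S d-odd 1<d d∣E) E≡ O-at-d

  odd⇒%2≡1 : ∀ {a} → ¬ 2 ∣ a → a % 2 ≡ 1
  odd⇒%2≡1 {a} a-odd with a % 2 in a%2≡r | m%n<n a 2
  ... | 0 | _ = contradiction (m%n≡0⇒n∣m a 2 a%2≡r) a-odd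
  ... | 1 | _ = refl
  ... | suc (suc _) | s≤s (s≤s ())

  odd+odd-even : ∀ {a b} → ¬ 2 ∣ a → ¬ 2 ∣ b → 2 ∣ a + b
  odd+odd-even {a} {b} a-odd b-odd = m%n≡0⇒n∣m (a + b) 2 (begin
    (a + b) % 2            ≡⟨ %-distribˡ-+ a b 2 ⟩
    (a % 2 + b % 2) % 2    ≡⟨ cong₂ (λ x y → (x + y) % 2) (odd⇒%2≡1 a-odd) (odd⇒%2≡1 b-odd) ⟩
    0                      ∎)
    where open ≡-Reasoning

  -- Two perfect numbers a and b = a + d with d odd, d > 1 and d ∣ a cannot
  -- exist: exactly one of them is even, d divides it, and the other is its
  -- neighbour at distance d.
  no-perfect-pair : ∀ {a b d} → Perfect a → Perfect b → b ≡ a + d → ¬ 2 ∣ d → 1 < d → d ∣ a → ⊥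
  no-perfect-pair {a} {b} {d} pa pb b≡a+d d-odd 1<d d∣a with 2 ∣? a
  ... | yes 2∣a = no-perfect-odd-neighbour pa 2∣a d-odd 1<d d∣a (inj₁ b≡a+d) pb
  ... | no a-odd = no-perfect-odd-neighbour pb 2∣b d-odd 1<d d∣b (inj₂ (sym b≡a+d)) pa
    where
    2∣b : 2 ∣ b
    2∣b = subst (2 ∣_) (sym b≡a+d) (odd+odd-even a-odd d-odd)
    d∣b : d ∣ b
    d∣b = subst (d ∣_) (sym b≡a+d) (∣m∣n⇒∣m+n d∣a ∣-refl)

open import Data.Nat using (ℕ; _<_)
open import Data.Integer using (ℤ; +_; -[1+_]; _+_; ∣_∣)
open import Data.Integer.Divisibility using (_∣_)
import Data.Integer.Divisibility.Signed as Signed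
import Data.Integer.Properties as ℤₚ
import Data.Nat as ℕ
import Data.Nat.Divisibility as ℕᵈ
import Data.Nat.Properties as ℕₚ
open import Data.Product using (Σ; _×_; _,_)
open import Relation.Binary.PropositionalEquality using (_≡_; sym; trans; cong; subst; module ≡-Reasoning)
open import Relation.Nullary using (¬_)
open PerfectPairs using (2∤1; no-perfect-pair)

odd-abs : ∀ {δ} → OddInt δ → ¬ (2 ℕᵈ.∣ ∣ δ ∣)
odd-abs {δ} (k , δ≡2k+1) 2∣∣δ∣ = 2∤1 (Signed.∣⇒∣ᵤ 2∣1)
  where
  2∣1 : + 2 Signed.∣ + 1
  2∣1 = Signed.∣m+n∣m⇒∣n (subst (+ 2 Signed.∣_) δ≡2k+1 (Signed.∣ᵤ⇒∣ 2∣∣δ∣))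
                         (Signed.∣m⇒∣m*n k Signed.∣-refl)

ℤ-difference⇒ℕ-sum : ∀ {m n j} → + m ≡ + n + -[1+ j ] → n ≡ m ℕ.+ ℕ.suc j
ℤ-difference⇒ℕ-sum {m} {n} {j} m≡n-d = ℤₚ.+-injective (sym (begin
  + (m ℕ.+ ℕ.suc j)           ≡⟨ ℤₚ.pos-+ m (ℕ.suc j) ⟩
  + m + + ℕ.suc j             ≡⟨ cong (_+ + ℕ.suc j) m≡n-d ⟩
  + n + -[1+ j ] + + ℕ.suc j  ≡⟨ ℤₚ.+-assoc (+ n) -[1+ j ] (+ ℕ.suc j) ⟩
  + n + (-[1+ j ] + + ℕ.suc j) ≡⟨ cong (λ i → + n + i) (ℤₚ.+-inverseˡ (+ ℕ.suc j)) ⟩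
  + n + + 0                   ≡⟨ ℤₚ.+-identityʳ (+ n) ⟩
  + n                         ∎))
  where open ≡-Reasoning

-- With d = |δ|, the pair {n, n + δ} is {a, a + d} with d dividing both members.
lemma2p3 : (n : ℕ) (δ : ℤ) → 0 < n → OddInt δ → 1 < ∣ δ ∣ →
    Perfect n → Σ ℕ (λ m → (+ m ≡ + n + δ) × Perfect m) → ¬ (δ ∣ + n)
lemma2p3 n (+ d) _ δ-odd 1<d n-perfect (m , m≡n+d , m-perfect) d∣n =
  no-perfect-pair n-perfect m-perfect (ℤₚ.+-injective m≡n+d) (odd-abs δ-odd) 1<d d∣n
lemma2p3 n -[1+ j ] _ δ-odd 1<d n-perfect (m , m≡n-d , m-perfect) d∣n =
  no-perfect-pair m-perfect n-perfect n≡m+d (odd-abs δ-odd) 1<d d∣m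
  where
  n≡m+d : n ≡ m ℕ.+ ℕ.suc j
  n≡m+d = ℤ-difference⇒ℕ-sum m≡n-d
  d∣m : ℕ.suc j ℕᵈ.∣ m
  d∣m = ℕᵈ.∣m+n∣m⇒∣n (subst (ℕ.suc j ℕᵈ.∣_) (trans n≡m+d (ℕₚ.+-comm m (ℕ.suc j))) d∣n)
                      ℕᵈ.∣-refl
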